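{- Let $G$ be a 2-threshold graph. Then (a) $G$ has at most two connected components with at least two vertices; and (b) if $G$ has two connected components with at least two vertices, then one of them induces a threshold graph and the other induces a special 2-threshold graph.
   Context: Graphs are finite and simple. A threshold graph is a graph in which every induced subgraph has an isolated vertex or a universal vertex (a vertex adjacent to all other vertices). Consider colorings of vertices with two colors, black ($b$) and white ($w$) (any map). A graph $G=(V,E)$ is 2-threshold if for some black/white coloring, every nonempty $W\subseteq V$ contains a vertex $x$ that is isolated in $G[W]$ or adjacent in $G[W]$ to exactly the vertices of $W\setminus\{x\}$ of one fixed color. Equivalently, $G$ has an ordering $v_1,\ldots,v_n$ of its vertices with, for each $j\ge 2$, an operator among $\oplus$ ($v_j$ adjacent to none of $v_1,\ldots,v_{j-1}$), $\otimes_b$ ($v_j$ adjacent exactly to the black vertices among $v_1,\ldots,v_{j-1}$), $\otimes_w$ ($v_j$ adjacent exactly to the white ones among them). A 2-threshold graph is special if it has a coloring and such an ordering using only $\oplus$- and $\otimes_w$-operators. -}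

module Defs where

open import Data.Nat using (ℕ; _≤_; _<_)
open import Data.Fin using (Fin; toℕ; _<_)
open import Data.Fin.Subset using (Subset; _∈_; _⊆_; Nonempty; ∣_∣)
open import Data.Fin.Permutation using (Permutation′; _⟨$⟩ʳ_)
open import Data.Bool using (Bool; true; false)
open import Data.Product using (Σ; ∃; ∃-syntax; _×_; _,_)
open import Data.Sum using (_⊎_)
open import Function.Bundles using (_⇔_)
open import Relation.Binary.PropositionalEquality using (_≡_; _≢_)
open import Relation.Binary.Construct.Closure.ReflexiveTransitive using (Star)
open import Function.Definitions using (Injective)

record Graph (n : ℕ) : Set where
  field
    adj   : Fin n → Fin n → Bool
    sym   : ∀ u v → adj u v ≡ adj v u
    irrefl : ∀ v → adj v v ≡ false
open Graph public

_~_ : ∀ {n} → Graph n → Fin n → Fin n → Set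
(G ~ u) v = adj G u v ≡ true

data Color : Set where
  black white : Color

Threshold : ∀ {n} → Graph n → Set
Threshold {n} G = (W : Subset n) → Nonempty W →
  ∃[ x ] (x ∈ W ×
    ((∀ y → y ∈ W → y ≢ x → adj G x y ≡ false) ⊎
     (∀ y → y ∈ W → y ≢ x → adj G x y ≡ true)))

TwoThreshold : ∀ {n} → Graph n → Set
TwoThreshold {n} G = Σ (Fin n → Color) λ c → (W : Subset n) → Nonempty W →
  ∃[ x ] (x ∈ W ×
    ((∀ y → y ∈ W → y ≢ x → adj G x y ≡ false) ⊎
     (∃[ k ] (∀ y → y ∈ W → y ≢ x → ((adj G x y ≡ true) ⇔ (c y ≡ k))))))

-- Special: a coloring and an ordering v_i = σ i using only ⊕ and ⊗_w.
Special : ∀ {n} → Graph n → Set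
Special {n} G = Σ (Fin n → Color) λ c → Σ (Permutation′ n) λ σ →
  (j : Fin n) → 1 ≤ toℕ j →
    ((∀ (i : Fin n) → i Data.Fin.< j → adj G (σ ⟨$⟩ʳ j) (σ ⟨$⟩ʳ i) ≡ false) ⊎
     (∀ (i : Fin n) → i Data.Fin.< j →
        ((adj G (σ ⟨$⟩ʳ j) (σ ⟨$⟩ʳ i) ≡ true) ⇔ (c (σ ⟨$⟩ʳ i) ≡ white))))

Connected : ∀ {n} → Graph n → Fin n → Fin n → Set
Connected G = Star (G ~_)

IsComponent : ∀ {n} → Graph n → Subset n → Set
IsComponent G C = Nonempty C
  × (∀ u v → u ∈ C → v ∈ C → Connected G u v)
  × (∀ u v → u ∈ C → Connected G u v → v ∈ C)

IsInducedBy : ∀ {n m} → Graph n → Subset n → Graph m → (Fin m → Fin n) → Set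
IsInducedBy {n} {m} G C H f = Injective _≡_ _≡_ f
  × (∀ v → v ∈ C ⇔ (∃[ i ] f i ≡ v))
  × (∀ i j → adj H i j ≡ adj G (f i) (f j))

-- "G[C] has property P" (P is invariant under isomorphism).
InducedHas : ∀ {n} → (∀ {m} → Graph m → Set) → Graph n → Subset n → Set
InducedHas P G C = ∃[ m ] Σ (Graph m) λ H → Σ (Fin m → Fin _) λ f →
  IsInducedBy G C H f × P H

BigComponent : ∀ {n} → Graph n → Subset n → Set
BigComponent G C = IsComponent G C × 2 ≤ ∣ C ∣

module Submission where

-- Fix a colouring c witnessing that G is 2-threshold.  The heart of the proof is
-- matching-split: apply the 2-threshold condition to the set of all endpoints of
-- an induced matching.  The chosen vertex x has its mate p as a neighbour, so x
-- is adjacent exactly to the colour c p, and every endpoint of another edge (a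
-- non-neighbour of x) has a different colour.  Hence an induced matching with at
-- least two edges has a monochromatic edge and is not single-coloured, so there is
-- no induced matching with three edges.  Edges chosen in distinct components form
-- induced matchings: this gives (a), and shows that of two big components at most
-- one has a bichromatic edge.  The other, C₁, is single-coloured, so on subsets of
-- C₁ the condition reads "isolated or universal": G[C₁] is threshold.  Adding an
-- edge a — b of C₁ to any W inside the second component forces a vertex of W that
-- is isolated or adjacent exactly to the colours ≠ c a: G[C₂] is special.

open import Defs hiding (sym)
open import Data.Nat using (ℕ)
open import Data.Fin.Subset using (Subset)
open import Data.Product using (_×_)
open import Data.Sum using (_⊎_)
open import Relation.Binary.PropositionalEquality using (_≡_; _≢_)

open import Level using (0ℓ)
open import Data.Bool using (true; false)
open import Data.Bool.Properties using (T-≡; ¬-not) renaming (_≟_ to _≟ᵇ_)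
open import Data.Empty using (⊥; ⊥-elim)
open import Data.Nat as ℕ using (zero; suc; _+_)
open import Data.Nat.Properties using (<-asym; ≤-trans)
open import Data.Fin using (Fin; zero; suc; toℕ; fromℕ; inject₁; punchIn; _<_; _≟_)
open import Data.Fin.Properties
  using (any?; suc-injective; toℕ-fromℕ; toℕ-inject₁; inject₁ℕ<; <⇒≢; punchIn-injective; punchInᵢ≢i)
open import Data.Fin.Relation.Unary.Top using (view; ‵fromℕ; ‵inj₁)
open import Data.Fin.Permutation using (Permutation′; _⟨$⟩ʳ_; insert; insert-punchIn)
  renaming (id to idₚ)
open import Data.Fin.Subset using (_∈_; _⊆_; Nonempty; ⊤; ⁅_⁆; _∪_; ∣_∣)
open import Data.Fin.Subset.Properties
  using (_∈?_; ∈⊤; x∈⁅x⁆; x∈⁅y⁆⇔x≡y; x∈p∪q⁻; x∈p∪q⁺; ⊆-antisym; p⊆q⇒∣p∣≤∣q∣; ∣⁅x⁆∣≡1)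
open import Data.Product using (Σ; ∃; ∃-syntax; _,_; proj₁; proj₂)
open import Data.Sum as Sum using (inj₁; inj₂)
open import Data.Vec using (Vec; []; _∷_; lookup; tabulate; here; there)
open import Data.Vec.Properties using ([]=⇒lookup; lookup⇒[]=; lookup∘tabulate; ≡-dec)
open import Data.Vec.Relation.Unary.All as All using (All; []; _∷_)
open import Data.Vec.Relation.Unary.All.Properties using (lookup⁺)
open import Data.Vec.Relation.Unary.AllPairs using ([]; _∷_)
open import Data.Vec.Relation.Unary.Unique.Propositional using (Unique)
open import Data.Vec.Relation.Unary.Unique.Propositional.Properties using (lookup-injective)
open import Function using (id; _∘_; _on_; const)
open import Function.Bundles using (_⇔_; mk⇔; Equivalence; Injection)
open import Function.Definitions using (Injective)
open import Function.Properties.Inverse using (↔⇒↣)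
open import Relation.Binary using (Rel; DecidableEquality)
open import Relation.Binary.Construct.Closure.ReflexiveTransitive using (ε; _◅_)
open import Relation.Binary.PropositionalEquality using (refl; sym; trans; cong; subst; subst₂)
open import Relation.Nullary using (Dec; yes; no; ¬_)
open import Relation.Nullary.Decidable
  using (isYes; toWitness; fromWitness; _×-dec_; _⊎-dec_; ¬?; map′)
open import Relation.Unary using (Pred; Decidable)

open Equivalence using (to; from)

private
  variable
    m n : ℕ

subsetOf : {P : Pred (Fin n) 0ℓ} → Decidable P → Subset n
subsetOf P? = tabulate (λ v → isYes (P? v))

∈-subsetOf : {P : Pred (Fin n) 0ℓ} (P? : Decidable P) {v : Fin n} → v ∈ subsetOf P? ⇔ P v
∈-subsetOf P? {v} = mk⇔
  (λ v∈ → toWitness (from T-≡ (trans (sym (lookup∘tabulate _ v)) ([]=⇒lookup v∈))))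
  (λ Pv → lookup⇒[]= v _ (trans (lookup∘tabulate _ v) (to T-≡ (fromWitness Pv))))

image : (Fin m → Fin n) → Subset m → Subset n
image e W = subsetOf (λ v → any? (λ i → (i ∈? W) ×-dec (e i ≟ v)))

∈-image : ∀ (e : Fin m → Fin n) W {v} → v ∈ image e W ⇔ (∃[ i ] (i ∈ W × e i ≡ v))
∈-image e W = ∈-subsetOf _

image-intro : ∀ (e : Fin m → Fin n) {W i} → i ∈ W → e i ∈ image e W
image-intro e {W} i∈W = from (∈-image e W) (_ , i∈W , refl)

Removable : (R₁ R₂ : Rel (Fin n) 0ℓ) → Subset n → Fin n → Set
Removable R₁ R₂ W x =
  (∀ y → y ∈ W → y ≢ x → R₁ x y) ⊎ (∀ y → y ∈ W → y ≢ x → R₂ x y)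

-- Every nonempty set of vertices has a removable vertex.  For R₁ = non-adjacency
-- and R₂ = adjacency this is exactly the definition of a threshold graph.
Eliminable : (R₁ R₂ : Rel (Fin n) 0ℓ) → Set
Eliminable {n} R₁ R₂ = (W : Subset n) → Nonempty W → ∃[ x ] (x ∈ W × Removable R₁ R₂ W x)

EliminableWithin : Subset n → (R₁ R₂ : Rel (Fin n) 0ℓ) → Set
EliminableWithin {n} D R₁ R₂ =
  (W : Subset n) → W ⊆ D → Nonempty W → ∃[ x ] (x ∈ W × Removable R₁ R₂ W x)

eliminable-pullback : ∀ {D : Subset n} {R₁ R₂ : Rel (Fin n) 0ℓ} (e : Fin m → Fin n) →
  Injective _≡_ _≡_ e → (∀ i → e i ∈ D) →
  EliminableWithin D R₁ R₂ → Eliminable (R₁ on e) (R₂ on e)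
eliminable-pullback {n = n} {D = D} {R₁} {R₂} e e-injective e∈D eliminable W (i , i∈W) =
  pull-back (eliminable (image e W) image⊆D (e i , image-intro e i∈W))
  where
  image⊆D : image e W ⊆ D
  image⊆D v∈ with to (∈-image e W) v∈
  ... | j , _ , refl = e∈D j

  pull-back : ∃[ x ] (x ∈ image e W × Removable R₁ R₂ (image e W) x) →
              ∃[ a ] (a ∈ W × Removable (R₁ on e) (R₂ on e) W a)
  pull-back (x , x∈ , removable) with to (∈-image e W) x∈
  ... | a , a∈W , refl = a , a∈W , Sum.map (restrict {R₁}) (restrict {R₂}) removable
    where
    restrict : ∀ {R : Rel (Fin n) 0ℓ} → (∀ y → y ∈ image e W → y ≢ e a → R (e a) y) →
               ∀ b → b ∈ W → b ≢ a → R (e a) (e b)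
    restrict h b b∈W b≢a = h (e b) (image-intro e b∈W) (b≢a ∘ e-injective)

EliminationOrder : (R₁ R₂ : Rel (Fin n) 0ℓ) → Permutation′ n → Set
EliminationOrder R₁ R₂ σ = ∀ j →
  (∀ i → i < j → R₁ (σ ⟨$⟩ʳ j) (σ ⟨$⟩ʳ i)) ⊎ (∀ i → i < j → R₂ (σ ⟨$⟩ʳ j) (σ ⟨$⟩ʳ i))

punchIn-fromℕ : ∀ {k} (a : Fin k) → punchIn (fromℕ k) a ≡ inject₁ a
punchIn-fromℕ zero    = refl
punchIn-fromℕ (suc a) = cong suc (punchIn-fromℕ a)

fromℕ≮inject₁ : ∀ {k} (a : Fin k) → ¬ (fromℕ k < inject₁ a)
fromℕ≮inject₁ {k} a top<a =
  <-asym (inject₁ℕ< a) (subst (ℕ._< toℕ (inject₁ a)) (toℕ-fromℕ k) top<a)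

inject₁-cancel-< : ∀ {k} {a b : Fin k} → inject₁ b < inject₁ a → b < a
inject₁-cancel-< {a = a} {b} = subst₂ ℕ._<_ (toℕ-inject₁ b) (toℕ-inject₁ a)

-- Eliminability yields an elimination order: remove a removable vertex x of the
-- whole set, order the rest recursively and put x last.
elimination-order : {R₁ R₂ : Rel (Fin n) 0ℓ} → Eliminable R₁ R₂ → Σ (Permutation′ n) (EliminationOrder R₁ R₂)
elimination-order {zero} _ = idₚ , λ ()
elimination-order {suc k} {R₁} {R₂} eliminable
  with eliminable ⊤ (zero , ∈⊤)
... | x , _ , x-removable
  with elimination-order (eliminable-pullback (punchIn x) (punchIn-injective x _ _)
                            (λ _ → ∈⊤) (λ W _ → eliminable W))
... | σ′ , σ′-order = σ , order
  where
  σ : Permutation′ (suc k)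
  σ = insert (fromℕ k) x σ′

  σ-injective : Injective _≡_ _≡_ (σ ⟨$⟩ʳ_)
  σ-injective = Injection.injective (↔⇒↣ σ)

  σ-top : σ ⟨$⟩ʳ fromℕ k ≡ x
  σ-top with fromℕ k ≟ fromℕ k
  ... | yes _    = refl
  ... | no top≢top = ⊥-elim (top≢top refl)

  σ-inject₁ : ∀ a → σ ⟨$⟩ʳ inject₁ a ≡ punchIn x (σ′ ⟨$⟩ʳ a)
  σ-inject₁ a = subst (λ j → σ ⟨$⟩ʳ j ≡ punchIn x (σ′ ⟨$⟩ʳ a))
                      (punchIn-fromℕ a) (insert-punchIn (fromℕ k) x σ′ a)

  top : ∀ {R : Rel (Fin (suc k)) 0ℓ} → (∀ y → y ∈ ⊤ → y ≢ x → R x y) →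
        ∀ i → i < fromℕ k → R (σ ⟨$⟩ʳ fromℕ k) (σ ⟨$⟩ʳ i)
  top {R} h i i<top = subst (λ z → R z (σ ⟨$⟩ʳ i)) (sym σ-top)
    (h (σ ⟨$⟩ʳ i) ∈⊤ (λ σi≡x → <⇒≢ i<top (σ-injective (trans σi≡x (sym σ-top)))))

  below : ∀ {R : Rel (Fin (suc k)) 0ℓ} a →
          (∀ b → b < a → R (punchIn x (σ′ ⟨$⟩ʳ a)) (punchIn x (σ′ ⟨$⟩ʳ b))) →
          ∀ i → i < inject₁ a → R (σ ⟨$⟩ʳ inject₁ a) (σ ⟨$⟩ʳ i)
  below {R} a h i i<a with view i
  ... | ‵fromℕ = ⊥-elim (fromℕ≮inject₁ a i<a)
  ... | ‵inj₁ {i = b} _ =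
    subst₂ R (sym (σ-inject₁ a)) (sym (σ-inject₁ b)) (h b (inject₁-cancel-< i<a))

  order : EliminationOrder R₁ R₂ σ
  order j with view j
  ... | ‵fromℕ = Sum.map (top {R₁}) (top {R₂}) x-removable
  ... | ‵inj₁ {i = a} _ = Sum.map (below {R₁} a) (below {R₂} a) (σ′-order a)

size : Subset n → ℕ
size []            = 0
size (true  ∷ C)   = suc (size C)
size (false ∷ C)   = size C

enumerate : (C : Subset n) → Fin (size C) → Fin n
enumerate (true  ∷ C) zero    = zero
enumerate (true  ∷ C) (suc i) = suc (enumerate C i)
enumerate (false ∷ C) i       = suc (enumerate C i)

enumerate-injective : (C : Subset n) → Injective _≡_ _≡_ (enumerate C)
enumerate-injective (true ∷ C) {zero}  {zero}  _  = refl
enumerate-injective (true ∷ C) {suc i} {suc j} eq = cong suc (enumerate-injective C (suc-injective eq))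
enumerate-injective (false ∷ C) eq = enumerate-injective C (suc-injective eq)

enumerate-∈ : (C : Subset n) (i : Fin (size C)) → enumerate C i ∈ C
enumerate-∈ (true  ∷ C) zero    = here
enumerate-∈ (true  ∷ C) (suc i) = there (enumerate-∈ C i)
enumerate-∈ (false ∷ C) i       = there (enumerate-∈ C i)

enumerate-onto : (C : Subset n) {v : Fin n} → v ∈ C → ∃[ i ] (enumerate C i ≡ v)
enumerate-onto (true ∷ C) here = zero , refl
enumerate-onto (true ∷ C) (there v∈C) with enumerate-onto C v∈C
... | i , refl = suc i , refl
enumerate-onto (false ∷ C) (there v∈C) with enumerate-onto C v∈C
... | i , refl = i , refl

induced : Graph n → (C : Subset n) → Graph (size C)
induced G C = record
  { adj    = adj G on enumerate C
  ; sym    = λ i j → Graph.sym G (enumerate C i) (enumerate C j)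
  ; irrefl = λ i → irrefl G (enumerate C i)
  }

induced-isInducedBy : (G : Graph n) (C : Subset n) → IsInducedBy G C (induced G C) (enumerate C)
induced-isInducedBy G C =
  enumerate-injective C ,
  (λ v → mk⇔ (enumerate-onto C) (λ { (i , refl) → enumerate-∈ C i })) ,
  (λ i j → refl)

NonAdjacent : Graph n → Rel (Fin n) 0ℓ
NonAdjacent G x y = adj G x y ≡ false

induced-threshold : (G : Graph n) (C : Subset n) →
  EliminableWithin C (NonAdjacent G) (G ~_) → InducedHas Threshold G C
induced-threshold G C eliminable =
  size C , induced G C , enumerate C , induced-isInducedBy G C ,
  eliminable-pullback (enumerate C) (enumerate-injective C) (enumerate-∈ C) eliminable

induced-special : (G : Graph n) (C : Subset n) (c : Fin n → Color) →
  EliminableWithin C (NonAdjacent G) (λ x y → (G ~ x) y ⇔ c y ≡ white) →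
  InducedHas Special G C
induced-special G C c eliminable
  with elimination-order (eliminable-pullback (enumerate C) (enumerate-injective C) (enumerate-∈ C) eliminable)
... | σ , order = size C , induced G C , enumerate C , induced-isInducedBy G C ,
                  (c ∘ enumerate C , σ , λ j _ → order j)

adjacent-sym : (G : Graph n) {x y : Fin n} → (G ~ x) y → (G ~ y) x
adjacent-sym G {x} {y} xy = trans (Graph.sym G y x) xy

adjacent⇒≢ : (G : Graph n) {x y : Fin n} → (G ~ x) y → x ≢ y
adjacent⇒≢ G {x} xx refl with trans (sym (irrefl G x)) xx
... | ()

record EdgeIn (G : Graph n) (C : Subset n) : Set where
  constructor edge
  field
    src tgt  : Fin n
    src∈     : src ∈ C
    tgt∈     : tgt ∈ C
    adjacent : (G ~ src) tgt
open EdgeIn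

Endpoint : (s t : Fin m → Fin n) → Fin m → Fin n → Set
Endpoint s t i v = v ≡ s i ⊎ v ≡ t i

record IsInducedMatching (G : Graph n) (s t : Fin m → Fin n) : Set where
  field
    edge-at : ∀ i → (G ~ s i) (t i)
    apart   : ∀ {i j u v} → i ≢ j → Endpoint s t i u → Endpoint s t j v →
              NonAdjacent G u v × u ≢ v
open IsInducedMatching

mate : ∀ {G : Graph n} {s t : Fin m → Fin n} {i x} → IsInducedMatching G s t →
       Endpoint s t i x → ∃[ p ] (Endpoint s t i p × (G ~ x) p)
mate {i = i} M (inj₁ refl) = _ , inj₂ refl , edge-at M i
mate {G = G} {i = i} M (inj₂ refl) = _ , inj₁ refl , adjacent-sym G (edge-at M i)

matching-reindex : ∀ {k} {G : Graph n} {s t : Fin m → Fin n} → IsInducedMatching G s t →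
  (f : Fin k → Fin m) → Injective _≡_ _≡_ f → IsInducedMatching G (s ∘ f) (t ∘ f)
matching-reindex M f f-injective = record
  { edge-at = edge-at M ∘ f
  ; apart   = λ i≢j → apart M (i≢j ∘ f-injective)
  }

same-component : ∀ {G : Graph n} {C₁ C₂ v} → IsComponent G C₁ → IsComponent G C₂ →
  v ∈ C₁ → v ∈ C₂ → C₁ ≡ C₂
same-component {v = v} (_ , connected₁ , closed₁) (_ , connected₂ , closed₂) v∈C₁ v∈C₂ =
  ⊆-antisym (λ {u} u∈C₁ → closed₂ v u v∈C₂ (connected₁ v u v∈C₁ u∈C₁))
            (λ {u} u∈C₂ → closed₁ v u v∈C₁ (connected₂ v u v∈C₂ u∈C₂))

components-apart : ∀ {G : Graph n} {C₁ C₂ u v} → IsComponent G C₁ → IsComponent G C₂ →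
  C₁ ≢ C₂ → u ∈ C₁ → v ∈ C₂ → NonAdjacent G u v × u ≢ v
components-apart {G = G} {u = u} {v} K₁ K₂ C₁≢C₂ u∈C₁ v∈C₂ =
  not-adjacent , λ { refl → C₁≢C₂ (same-component {G = G} K₁ K₂ u∈C₁ v∈C₂) }
  where
  not-adjacent : NonAdjacent G u v
  not-adjacent = ¬-not λ uv →
    C₁≢C₂ (same-component {G = G} K₁ K₂ (proj₂ (proj₂ K₁) u v u∈C₁ (uv ◅ ε)) v∈C₂)

big-component-edge : ∀ {G : Graph n} {C} → BigComponent G C → EdgeIn G C
big-component-edge {G = G} {C} (((u , u∈C) , connected , closed) , ∣C∣≥2)
  with any? (λ v → (v ∈? C) ×-dec ¬? (v ≟ u))
... | yes (v , v∈C , v≢u) = first-step (connected u v u∈C v∈C) (v≢u ∘ sym)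
  where
  first-step : ∀ {w} → Connected G u w → u ≢ w → EdgeIn G C
  first-step ε u≢u = ⊥-elim (u≢u refl)
  first-step (uw ◅ _) _ = edge u _ u∈C (closed u _ u∈C (uw ◅ ε)) uw
... | no no-other =
  ⊥-elim (two≰one (≤-trans ∣C∣≥2 (subst (∣ C ∣ ℕ.≤_) (∣⁅x⁆∣≡1 u) (p⊆q⇒∣p∣≤∣q∣ C⊆⁅u⁆))))
  where
  C⊆⁅u⁆ : C ⊆ ⁅ u ⁆
  C⊆⁅u⁆ {v} v∈C with v ≟ u
  ... | yes refl = x∈⁅x⁆ u
  ... | no v≢u   = ⊥-elim (no-other (v , v∈C , v≢u))
  two≰one : ¬ (2 ℕ.≤ 1)
  two≰one (ℕ.s≤s ())

components-matching : ∀ {G : Graph n} (Cs : Vec (Subset n) m) → Unique Cs →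
  All (IsComponent G) Cs → (e : ∀ i → EdgeIn G (lookup Cs i)) →
  IsInducedMatching G (src ∘ e) (tgt ∘ e)
components-matching {G = G} Cs unique components e = record
  { edge-at = adjacent ∘ e
  ; apart   = λ {i} {j} i≢j u∈i v∈j →
      components-apart {G = G} (lookup⁺ components i) (lookup⁺ components j)
        (i≢j ∘ lookup-injective unique i j) (endpoint∈ u∈i) (endpoint∈ v∈j)
  }
  where
  endpoint∈ : ∀ {i v} → Endpoint (src ∘ e) (tgt ∘ e) i v → v ∈ lookup Cs i
  endpoint∈ {i} (inj₁ refl) = src∈ (e i)
  endpoint∈ {i} (inj₂ refl) = tgt∈ (e i)

endpoints : (s t : Fin m → Fin n) → Subset n
endpoints s t = subsetOf (λ v → any? (λ i → (v ≟ s i) ⊎-dec (v ≟ t i)))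

∈-endpoints : ∀ {s t : Fin m → Fin n} {v} → v ∈ endpoints s t ⇔ (∃[ i ] Endpoint s t i v)
∈-endpoints = ∈-subsetOf _

_≟ᶜ_ : (a b : Color) → Dec (a ≡ b)
black ≟ᶜ black = yes refl
black ≟ᶜ white = no λ ()
white ≟ᶜ black = no λ ()
white ≟ᶜ white = yes refl

other : Color → Color
other black = white
other white = black

≢⇒other : ∀ {a k} → a ≢ k → a ≡ other k
≢⇒other {black} {black} a≢k = ⊥-elim (a≢k refl)
≢⇒other {black} {white} _   = refl
≢⇒other {white} {black} _   = refl
≢⇒other {white} {white} a≢k = ⊥-elim (a≢k refl)

both-≢⇒≡ : ∀ {a b k} → a ≢ k → b ≢ k → a ≡ b
both-≢⇒≡ a≢k b≢k = trans (≢⇒other a≢k) (sym (≢⇒other b≢k))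

relativeTo : Color → Color → Color
relativeTo κ a with a ≟ᶜ κ
... | yes _ = black
... | no  _ = white

relativeTo-white : ∀ κ a → relativeTo κ a ≡ white ⇔ a ≢ κ
relativeTo-white κ a with a ≟ᶜ κ
... | yes a≡κ = mk⇔ (λ ()) (λ a≢κ → ⊥-elim (a≢κ a≡κ))
... | no  a≢κ = mk⇔ (const a≢κ) (const refl)

Bichromatic : Graph n → (Fin n → Color) → Subset n → Set
Bichromatic G c C = Σ (EdgeIn G C) (λ e → c (src e) ≢ c (tgt e))

bichromatic? : (G : Graph n) (c : Fin n → Color) (C : Subset n) → Dec (Bichromatic G c C)
bichromatic? G c C =
  map′ (λ { (u , v , u∈C , v∈C , uv , cu≢cv) → edge u v u∈C v∈C uv , cu≢cv })
       (λ { (edge u v u∈C v∈C uv , cu≢cv) → u , v , u∈C , v∈C , uv , cu≢cv })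
       (any? λ u → any? λ v →
          (u ∈? C) ×-dec (v ∈? C) ×-dec (adj G u v ≟ᵇ true) ×-dec ¬? (c u ≟ᶜ c v))

monochromatic-component : ∀ {G : Graph n} {c : Fin n → Color} {C} → IsComponent G C →
  ¬ Bichromatic G c C → ∀ {a v} → a ∈ C → v ∈ C → c v ≡ c a
monochromatic-component {G = G} {c} {C} (_ , connected , closed) no-bichromatic {a} {v} a∈C v∈C =
  sym (along (connected a v a∈C v∈C) a∈C)
  where
  neighbour∈ : ∀ {u u′} → (G ~ u) u′ → u ∈ C → u′ ∈ C
  neighbour∈ uu′ u∈C = closed _ _ u∈C (uu′ ◅ ε)

  along : ∀ {u w} → Connected G u w → u ∈ C → c u ≡ c w
  along ε _ = refl
  along {u} (_◅_ {j = u′} uu′ rest) u∈C with c u ≟ᶜ c u′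
  ... | yes cu≡cu′ = trans cu≡cu′ (along rest (neighbour∈ uu′ u∈C))
  ... | no  cu≢cu′ = ⊥-elim (no-bichromatic (edge u u′ u∈C (neighbour∈ uu′ u∈C) uu′ , cu≢cu′))


Response : Graph n → (Fin n → Color) → Subset n → Fin n → Set
Response G c W x =
  (∀ y → y ∈ W → y ≢ x → adj G x y ≡ false) ⊎
  (∃[ k ] (∀ y → y ∈ W → y ≢ x → ((adj G x y ≡ true) ⇔ (c y ≡ k))))

TwoThresholdWith : Graph n → (Fin n → Color) → Set
TwoThresholdWith {n} G c = (W : Subset n) → Nonempty W → ∃[ x ] (x ∈ W × Response G c W x)

module Coloured {n} (G : Graph n) (c : Fin n → Color) (two-threshold : TwoThresholdWith G c) where

  clash : ∀ {x y} → NonAdjacent G x y → (G ~ x) y → ⊥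
  clash xy-false xy-true with trans (sym xy-false) xy-true
  ... | ()

  -- If x has a neighbour p in W, its response must be "adjacent to colour c p";
  -- hence every non-neighbour of x in W has a colour different from p.
  partner-colour : ∀ {W x p} → Response G c W x → p ∈ W → (G ~ x) p →
    ∀ {u} → u ∈ W → u ≢ x → NonAdjacent G x u → c u ≢ c p
  partner-colour {p = p} (inj₁ isolated) p∈W xp _ _ _ _ =
    clash (isolated p p∈W (adjacent⇒≢ G xp ∘ sym)) xp
  partner-colour {p = p} (inj₂ (k , exactly)) p∈W xp {u} u∈W u≢x xu cu≡cp =
    clash xu (from (exactly u u∈W u≢x) (trans cu≡cp (to (exactly p p∈W (adjacent⇒≢ G xp ∘ sym)) xp)))

  monochromatic-removable : ∀ {W k} → (∀ {y} → y ∈ W → c y ≡ k) → Nonempty W →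
    ∃[ x ] (x ∈ W × Removable (NonAdjacent G) (G ~_) W x)
  monochromatic-removable {W} {k} mono nonempty with two-threshold W nonempty
  ... | x , x∈W , inj₁ isolated = x , x∈W , inj₁ isolated
  ... | x , x∈W , inj₂ (k′ , exactly) with k ≟ᶜ k′
  ...   | yes refl = x , x∈W , inj₂ (λ y y∈W y≢x → from (exactly y y∈W y≢x) (mono y∈W))
  ...   | no  k≢k′ = x , x∈W , inj₁ (λ y y∈W y≢x → ¬-not λ xy →
                       k≢k′ (trans (sym (mono y∈W)) (to (exactly y y∈W y≢x) xy)))

  -- Key lemma: in an induced matching some edge has an endpoint p such that all
  -- endpoints of the other edges have colours different from p.  (Apply the
  -- 2-threshold condition to the set of all endpoints: the chosen vertex has
  -- its mate as a neighbour and everything else as non-neighbours.)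
  matching-split : ∀ {m} {s t : Fin (suc m) → Fin n} → IsInducedMatching G s t →
    ∃[ i ] ∃[ p ] (Endpoint s t i p × (∀ {j u} → j ≢ i → Endpoint s t j u → c u ≢ c p))
  matching-split {s = s} {t} M
    with two-threshold (endpoints s t) (s zero , from ∈-endpoints (zero , inj₁ refl))
  ... | x , x∈W , response with to ∈-endpoints x∈W
  ... | i , x-end with mate M x-end
  ... | p , p-end , xp = i , p , p-end , λ {j} {u} j≢i u-end →
    partner-colour response (from ∈-endpoints (i , p-end)) xp (from ∈-endpoints (j , u-end))
      (proj₂ (apart M (j≢i ∘ sym) x-end u-end) ∘ sym) (proj₁ (apart M (j≢i ∘ sym) x-end u-end))

  some-edge-monochromatic : ∀ {m} {s t : Fin (2 + m) → Fin n} → IsInducedMatching G s t →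
    ∃[ j ] (c (s j) ≡ c (t j))
  some-edge-monochromatic M =
    let (i , _ , _ , avoid) = matching-split M
        j≢i = punchInᵢ≢i i zero
    in punchIn i zero , both-≢⇒≡ (avoid j≢i (inj₁ refl)) (avoid j≢i (inj₂ refl))

  not-one-colour : ∀ {m} {s t : Fin (2 + m) → Fin n} → IsInducedMatching G s t →
    ∀ k → ¬ (∀ {j u} → Endpoint s t j u → c u ≡ k)
  not-one-colour M k one-colour =
    let (i , _ , p-end , avoid) = matching-split M
    in avoid (punchInᵢ≢i i zero) (inj₁ refl) (trans (one-colour (inj₁ refl)) (sym (one-colour p-end)))

  -- There is no induced matching with three edges: the edges other than the one
  -- found by matching-split would all share the colour opposite to p.
  no-induced-3-matching : ∀ {m} {s t : Fin (3 + m) → Fin n} → ¬ IsInducedMatching G s t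
  no-induced-3-matching M =
    let (i , p , _ , avoid) = matching-split M
    in not-one-colour (matching-reindex M (punchIn i) (punchIn-injective i _ _)) (other (c p))
      (λ u-end → ≢⇒other (avoid (punchInᵢ≢i i _) u-end))

  monochromatic-threshold : ∀ {D k} → (∀ {v} → v ∈ D → c v ≡ k) →
    EliminableWithin D (NonAdjacent G) (G ~_)
  monochromatic-threshold mono W W⊆D = monochromatic-removable (mono ∘ W⊆D)

  AdjacentOff : Color → Rel (Fin n) 0ℓ
  AdjacentOff κ x y = (G ~ x) y ⇔ relativeTo κ (c y) ≡ white

  -- Let a — b be an edge with both ends coloured κ, and D a set of vertices not
  -- adjacent to a or b.  Then every nonempty W ⊆ D has a vertex isolated in W or
  -- adjacent in W exactly to the vertices not coloured κ.  (Apply the 2-threshold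
  -- condition to W ∪ {a, b}: if a or b is chosen, W avoids colour κ and is
  -- single-coloured; if x ∈ W is chosen, its colour k differs from c a = κ.)
  special-beside-edge : ∀ {a b κ D} → (G ~ a) b → c a ≡ κ → c b ≡ κ →
    (∀ {v} → v ∈ D → NonAdjacent G a v × NonAdjacent G b v) →
    EliminableWithin D (NonAdjacent G) (AdjacentOff κ)
  special-beside-edge {a} {b} {κ} {D} ab ca≡κ cb≡κ far W W⊆D (v , v∈W) =
    choose (two-threshold W⁺ (v , W⊆W⁺ v∈W))
    where
    W⁺ : Subset n
    W⁺ = ⁅ a ⁆ ∪ (⁅ b ⁆ ∪ W)

    a∈W⁺ : a ∈ W⁺
    a∈W⁺ = x∈p∪q⁺ (inj₁ (x∈⁅x⁆ a))

    b∈W⁺ : b ∈ W⁺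
    b∈W⁺ = x∈p∪q⁺ (inj₂ (x∈p∪q⁺ (inj₁ (x∈⁅x⁆ b))))

    W⊆W⁺ : W ⊆ W⁺
    W⊆W⁺ y∈W = x∈p∪q⁺ (inj₂ (x∈p∪q⁺ (inj₂ y∈W)))

    W⁺-cases : ∀ {x} → x ∈ W⁺ → x ≡ a ⊎ x ≡ b ⊎ x ∈ W
    W⁺-cases x∈W⁺ with x∈p∪q⁻ _ _ x∈W⁺
    ... | inj₁ x∈⁅a⁆ = inj₁ (to x∈⁅y⁆⇔x≡y x∈⁅a⁆)
    ... | inj₂ x∈bW with x∈p∪q⁻ _ _ x∈bW
    ...   | inj₁ x∈⁅b⁆ = inj₂ (inj₁ (to x∈⁅y⁆⇔x≡y x∈⁅b⁆))
    ...   | inj₂ x∈W   = inj₂ (inj₂ x∈W)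

    avoids-a : ∀ {y} → y ∈ W → y ≢ a
    avoids-a y∈W refl = clash (proj₂ (far (W⊆D y∈W))) (adjacent-sym G ab)

    avoids-b : ∀ {y} → y ∈ W → y ≢ b
    avoids-b y∈W refl = clash (proj₁ (far (W⊆D y∈W))) ab

    Goal : Set
    Goal = ∃[ x ] (x ∈ W × Removable (NonAdjacent G) (AdjacentOff κ) W x)


    -- The chosen vertex p is an end of the edge a — b, and q is the other end.
    from-endpoint : ∀ {p q} → Response G c W⁺ p → (G ~ p) q → q ∈ W⁺ → c q ≡ κ →
      (∀ {y} → y ∈ W → y ≢ p × NonAdjacent G p y) → Goal
    from-endpoint response pq q∈W⁺ cq≡κ near =
      let (x , x∈W , removable) = monochromatic-removable (≢⇒other ∘ not-κ) (v , v∈W)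
      in x , x∈W , Sum.map id (universal⇒white x) removable
      where
      not-κ : ∀ {y} → y ∈ W → c y ≢ κ
      not-κ y∈W cy≡κ = partner-colour response q∈W⁺ pq (W⊆W⁺ y∈W)
        (proj₁ (near y∈W)) (proj₂ (near y∈W)) (trans cy≡κ (sym cq≡κ))

      -- Every vertex of W avoids colour κ, so "universal" means "adjacent exactly off κ".
      universal⇒white : ∀ x → (∀ y → y ∈ W → y ≢ x → (G ~ x) y) →
        ∀ y → y ∈ W → y ≢ x → AdjacentOff κ x y
      universal⇒white x universal y y∈W y≢x =
        mk⇔ (const (from (relativeTo-white κ (c y)) (not-κ y∈W))) (const (universal y y∈W y≢x))

    from-inside : ∀ {x} → x ∈ W → Response G c W⁺ x →
      Removable (NonAdjacent G) (AdjacentOff κ) W x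
    from-inside x∈W (inj₁ isolated) = inj₁ (λ y y∈W → isolated y (W⊆W⁺ y∈W))
    from-inside {x} x∈W (inj₂ (k , exactly)) = inj₂ λ y y∈W y≢x →
      mk⇔ (λ xy → from (relativeTo-white κ (c y))
                    (λ cy≡κ → k≢κ (trans (sym (to (exactly y (W⊆W⁺ y∈W) y≢x) xy)) cy≡κ)))
          (λ white → from (exactly y (W⊆W⁺ y∈W) y≢x)
                    (both-≢⇒≡ (to (relativeTo-white κ (c y)) white) k≢κ))
      where
      k≢κ : k ≢ κ
      k≢κ k≡κ = clash (trans (Graph.sym G x a) (proj₁ (far (W⊆D x∈W))))
        (from (exactly a a∈W⁺ (avoids-a x∈W ∘ sym)) (trans ca≡κ (sym k≡κ)))

    choose : ∃[ x ] (x ∈ W⁺ × Response G c W⁺ x) → Goal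
    choose (x , x∈W⁺ , response) with W⁺-cases x∈W⁺
    ... | inj₁ refl = from-endpoint response ab b∈W⁺ cb≡κ
                        (λ y∈W → avoids-a y∈W , proj₁ (far (W⊆D y∈W)))
    ... | inj₂ (inj₁ refl) = from-endpoint response (adjacent-sym G ab) a∈W⁺ ca≡κ
                        (λ y∈W → avoids-b y∈W , proj₂ (far (W⊆D y∈W)))
    ... | inj₂ (inj₂ x∈W) = x , x∈W , from-inside x∈W response

  threshold-and-special : ∀ {C₁ C₂} → BigComponent G C₁ → IsComponent G C₂ → C₁ ≢ C₂ →
    ¬ Bichromatic G c C₁ → InducedHas Threshold G C₁ × InducedHas Special G C₂
  threshold-and-special {C₁} {C₂} big₁ K₂ C₁≢C₂ no-bichromatic =
    induced-threshold G C₁ (monochromatic-threshold single-colour) ,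
    induced-special G C₂ (relativeTo (c a) ∘ c)
      (special-beside-edge ab refl (single-colour b∈C₁) far)
    where
    open EdgeIn (big-component-edge {G = G} big₁)
      renaming (src to a; tgt to b; src∈ to a∈C₁; tgt∈ to b∈C₁; adjacent to ab)

    single-colour : ∀ {v} → v ∈ C₁ → c v ≡ c a
    single-colour = monochromatic-component {G = G} (proj₁ big₁) no-bichromatic a∈C₁

    far : ∀ {v} → v ∈ C₂ → NonAdjacent G a v × NonAdjacent G b v
    far v∈C₂ = proj₁ (components-apart {G = G} (proj₁ big₁) K₂ C₁≢C₂ a∈C₁ v∈C₂) ,
               proj₁ (components-apart {G = G} (proj₁ big₁) K₂ C₁≢C₂ b∈C₁ v∈C₂)

  -- Two distinct components cannot both contain a bichromatic edge: those two
  -- edges would form an induced matching without a monochromatic edge.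
  not-both-bichromatic : ∀ {C₁ C₂} → IsComponent G C₁ → IsComponent G C₂ → C₁ ≢ C₂ →
    Bichromatic G c C₁ → Bichromatic G c C₂ → ⊥
  not-both-bichromatic {C₁} {C₂} K₁ K₂ C₁≢C₂ (e₁ , mixed₁) (e₂ , mixed₂) =
    conclude (some-edge-monochromatic
      (components-matching {G = G} (C₁ ∷ C₂ ∷ []) ((C₁≢C₂ ∷ []) ∷ [] ∷ []) (K₁ ∷ K₂ ∷ []) edges))
    where
    edges : ∀ i → EdgeIn G (lookup (C₁ ∷ C₂ ∷ []) i)
    edges zero       = e₁
    edges (suc zero) = e₂

    conclude : ∃[ j ] (c (src (edges j)) ≡ c (tgt (edges j))) → ⊥
    conclude (zero     , same) = mixed₁ same
    conclude (suc zero , same) = mixed₂ same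

  -- (a) There are no three pairwise distinct components with at least two
  -- vertices: edges in them would form an induced matching with three edges.
  no-three-big-components : ∀ {m} (Cs : Vec (Subset n) (3 + m)) → Unique Cs →
    All (BigComponent G) Cs → ⊥
  no-three-big-components Cs unique bigs = no-induced-3-matching
    (components-matching {G = G} Cs unique (All.map proj₁ bigs) (big-component-edge ∘ lookup⁺ bigs))

  -- (b) Of two distinct big components, one induces a threshold graph and the
  -- other a special 2-threshold graph, since at most one of them is bichromatic.
  two-big-components : ∀ {C₁ C₂} → BigComponent G C₁ → BigComponent G C₂ → C₁ ≢ C₂ →
    (InducedHas Threshold G C₁ × InducedHas Special G C₂) ⊎
    (InducedHas Threshold G C₂ × InducedHas Special G C₁)
  two-big-components {C₁} {C₂} big₁ big₂ C₁≢C₂ with bichromatic? G c C₁ | bichromatic? G c C₂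
  ... | no mono₁ | _        = inj₁ (threshold-and-special big₁ (proj₁ big₂) C₁≢C₂ mono₁)
  ... | yes _    | no mono₂ = inj₂ (threshold-and-special big₂ (proj₁ big₁) (C₁≢C₂ ∘ sym) mono₂)
  ... | yes bi₁  | yes bi₂  = ⊥-elim (not-both-bichromatic (proj₁ big₁) (proj₁ big₂) C₁≢C₂ bi₁ bi₂)

lemma2 : ∀ {n} (G : Graph n) → TwoThreshold G →
    (∀ (C₁ C₂ C₃ : Subset n) → BigComponent G C₁ → BigComponent G C₂ → BigComponent G C₃ →
       C₁ ≡ C₂ ⊎ C₁ ≡ C₃ ⊎ C₂ ≡ C₃)
    × (∀ (C₁ C₂ : Subset n) → BigComponent G C₁ → BigComponent G C₂ → C₁ ≢ C₂ →
       (InducedHas Threshold G C₁ × InducedHas Special G C₂)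
       ⊎ (InducedHas Threshold G C₂ × InducedHas Special G C₁))
lemma2 G (c , two-threshold) = at-most-two , λ _ _ → two-big-components
  where
  open Coloured G c two-threshold

  _≟ₛ_ : DecidableEquality (Subset _)
  _≟ₛ_ = ≡-dec _≟ᵇ_

  at-most-two : ∀ C₁ C₂ C₃ → BigComponent G C₁ → BigComponent G C₂ → BigComponent G C₃ →
    C₁ ≡ C₂ ⊎ C₁ ≡ C₃ ⊎ C₂ ≡ C₃
  at-most-two C₁ C₂ C₃ big₁ big₂ big₃ with C₁ ≟ₛ C₂ | C₁ ≟ₛ C₃ | C₂ ≟ₛ C₃
  ... | yes C₁≡C₂ | _         | _         = inj₁ C₁≡C₂
  ... | no _      | yes C₁≡C₃ | _         = inj₂ (inj₁ C₁≡C₃)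
  ... | no _      | no _      | yes C₂≡C₃ = inj₂ (inj₂ C₂≡C₃)
  ... | no C₁≢C₂  | no C₁≢C₃  | no C₂≢C₃  = ⊥-elim
    (no-three-big-components (C₁ ∷ C₂ ∷ C₃ ∷ [])
      ((C₁≢C₂ ∷ C₁≢C₃ ∷ []) ∷ (C₂≢C₃ ∷ []) ∷ [] ∷ []) (big₁ ∷ big₂ ∷ big₃ ∷ []))
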